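{- Let $k \ge 2$ be an integer, let $G$ be a graph of order $n$, and let $\beta := \beta^k(G)$. Then: (1) if $\beta > 0$, then $\delta(G) \ge (\beta + 1)k - 1$; and (2) if $\beta \ge 1$, then $\delta(G) \ge \max\left\{(\beta + 1)k - 1,\ n-\frac{n-1}{\beta}\right\}$.
   Context: All graphs are finite and simple; $\delta(G)$ is the minimum degree. For $S\subseteq V(G)$, $\Lambda^k_G(S)$ is the set of vertices with at least $k$ neighbors in $S$, and $\beta^k(G)=\min\{|\Lambda^k_G(S)|/|S| : S\subseteq V(G),\ |S|\ge k,\ \Lambda^k_G(S)\ne V(G)\}$, with $\beta^k(G)=0$ if $|V(G)|<k$. -}

module Defs where

open import Data.Bool using (Bool; true; false)
open import Data.Nat as ℕ using (ℕ; zero; suc; _⊓_; _≤ᵇ_)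
open import Data.Fin using (Fin)
open import Data.Fin.Subset using (Subset; ∣_∣; _∩_; ⊤)
open import Data.Vec using (tabulate; foldr₁)
open import Data.Integer using (+_)
open import Data.Rational using (ℚ; 0ℚ; 1ℚ; _/_; _÷_; _<_; _≤_; positive)
open import Data.Rational.Properties using (pos⇒nonZero; <-≤-trans)
open import Data.Product using (Σ; _×_; ∃)
open import Data.Sum using (_⊎_)
open import Relation.Binary.PropositionalEquality using (_≡_; _≢_)

record Graph (n : ℕ) : Set where
  field
    adj   : Fin n → Fin n → Bool
    sym   : ∀ u v → adj u v ≡ adj v u
    irrfl : ∀ v → adj v v ≡ false
open Graph public

N : ∀ {n} → Graph n → Fin n → Subset n
N G v = tabulate (adj G v)

degree : ∀ {n} → Graph n → Fin n → ℕ
degree G v = ∣ N G v ∣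

-- minimum degree δ(G) (junk value 0 for the empty graph)
δ : ∀ {n} → Graph n → ℕ
δ {zero}  G = 0
δ {suc n} G = foldr₁ _⊓_ (tabulate (degree G))

Λ : ∀ {n} → ℕ → Graph n → Subset n → Subset n
Λ k G S = tabulate (λ v → k ≤ᵇ ∣ N G v ∩ S ∣)

-- a / b as a rational (junk value 0 when b = 0; never used when |S| ≥ k ≥ 1)
ratio : ℕ → ℕ → ℚ
ratio a zero    = 0ℚ
ratio a (suc b) = + a / suc b

Admissible : ∀ {n} → ℕ → Graph n → Subset n → Set
Admissible k G S = (k ℕ.≤ ∣ S ∣) × (Λ k G S ≢ ⊤)

IsBeta : ∀ {n} → ℕ → Graph n → ℚ → Set
IsBeta {n} k G β =
  (n ℕ.< k × β ≡ 0ℚ)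
  ⊎ ((k ℕ.≤ n)
     × (Σ (Subset n) λ S → Admissible k G S × β ≡ ratio ∣ Λ k G S ∣ ∣ S ∣)
     × (∀ S → Admissible k G S → β ≤ ratio ∣ Λ k G S ∣ ∣ S ∣))

divPos : (p q : ℚ) → 0ℚ < q → ℚ
divPos p q h = (p ÷ q) {{pos⇒nonZero q {{positive h}}}}

{-# OPTIONS --safe #-}
module Submission where

-- Let v be a vertex of minimum degree d. If w ∈ Λᵏ(S) and |S| = k, then w is adjacent to
-- every vertex of S; hence Λᵏ(S) is disjoint from S, and lies inside N(v) whenever v ∈ S.
-- (1) Take a k-set S ∋ v that is either inside or around N[v] = {v} ∪ N(v). Then
-- |Λᵏ(S)| + k ≤ max(d + 1, k); as β > 0 forces Λᵏ(S) ≠ ∅, this gives βk ≤ |Λᵏ(S)| ≤ d + 1 − k.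
-- (2) Take S ⊇ V ∖ N(v) of size max(k, n − d). Then v has fewer than k neighbours in S, so
-- β|S| ≤ |Λᵏ(S)| ≤ n − 1, and n − d ≤ |S| ≤ (n − 1)/β.

module SubsetCounting where

  open import Data.Nat using (ℕ; suc; _+_; _≤_; _<_; _⊔_; s≤s)
  open import Data.Nat.Properties
  open import Data.Fin using (Fin)
  open import Data.Fin.Subset
  open import Data.Fin.Subset.Properties
  open import Data.Vec using (_∷_; []; here)
  open import Data.Product using (∃; _×_; _,_)
  open import Data.Sum using (_⊎_; inj₁; inj₂; [_,_]′)
  open import Relation.Nullary using (yes; no; contradiction)
  open import Relation.Binary.PropositionalEquality
    using (_≡_; _≢_; refl; sym; trans; cong; subst; module ≡-Reasoning)

  private variable
    n : ℕ
    p q r : Subset n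

  ∣p∪q∣+∣p∩q∣≡∣p∣+∣q∣ : ∀ (p q : Subset n) → ∣ p ∪ q ∣ + ∣ p ∩ q ∣ ≡ ∣ p ∣ + ∣ q ∣
  ∣p∪q∣+∣p∩q∣≡∣p∣+∣q∣ []            []            = refl
  ∣p∪q∣+∣p∩q∣≡∣p∣+∣q∣ (inside  ∷ p) (inside  ∷ q) = cong suc (begin
    ∣ p ∪ q ∣ + suc ∣ p ∩ q ∣    ≡⟨ +-suc ∣ p ∪ q ∣ ∣ p ∩ q ∣ ⟩
    suc (∣ p ∪ q ∣ + ∣ p ∩ q ∣)  ≡⟨ cong suc (∣p∪q∣+∣p∩q∣≡∣p∣+∣q∣ p q) ⟩
    suc (∣ p ∣ + ∣ q ∣)          ≡⟨ +-suc ∣ p ∣ ∣ q ∣ ⟨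
    ∣ p ∣ + suc ∣ q ∣            ∎)
    where open ≡-Reasoning
  ∣p∪q∣+∣p∩q∣≡∣p∣+∣q∣ (inside  ∷ p) (outside ∷ q) = cong suc (∣p∪q∣+∣p∩q∣≡∣p∣+∣q∣ p q)
  ∣p∪q∣+∣p∩q∣≡∣p∣+∣q∣ (outside ∷ p) (inside  ∷ q) =
    trans (cong suc (∣p∪q∣+∣p∩q∣≡∣p∣+∣q∣ p q)) (sym (+-suc ∣ p ∣ ∣ q ∣))
  ∣p∪q∣+∣p∩q∣≡∣p∣+∣q∣ (outside ∷ p) (outside ∷ q) = ∣p∪q∣+∣p∩q∣≡∣p∣+∣q∣ p q

  ∣p∪q∣≤∣p∣+∣q∣ : ∀ (p q : Subset n) → ∣ p ∪ q ∣ ≤ ∣ p ∣ + ∣ q ∣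
  ∣p∪q∣≤∣p∣+∣q∣ p q = m+n≤o⇒m≤o ∣ p ∪ q ∣ (≤-reflexive (∣p∪q∣+∣p∩q∣≡∣p∣+∣q∣ p q))

  Empty[p∩q]⇒∣p∪q∣≡∣p∣+∣q∣ : ∀ (p q : Subset n) → Empty (p ∩ q) → ∣ p ∪ q ∣ ≡ ∣ p ∣ + ∣ q ∣
  Empty[p∩q]⇒∣p∪q∣≡∣p∣+∣q∣ {n} p q p∩q-empty = begin
    ∣ p ∪ q ∣                ≡⟨ +-identityʳ ∣ p ∪ q ∣ ⟨
    ∣ p ∪ q ∣ + 0            ≡⟨ cong (∣ p ∪ q ∣ +_) ∣p∩q∣≡0 ⟨
    ∣ p ∪ q ∣ + ∣ p ∩ q ∣    ≡⟨ ∣p∪q∣+∣p∩q∣≡∣p∣+∣q∣ p q ⟩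
    ∣ p ∣ + ∣ q ∣            ∎
    where
    open ≡-Reasoning
    ∣p∩q∣≡0 : ∣ p ∩ q ∣ ≡ 0
    ∣p∩q∣≡0 = trans (cong ∣_∣ (Empty-unique p∩q-empty)) (∣⊥∣≡0 n)

  ∪-lub : p ⊆ r → q ⊆ r → p ∪ q ⊆ r
  ∪-lub {p = p} {q = q} p⊆r q⊆r x∈p∪q = [ p⊆r , q⊆r ]′ (x∈p∪q⁻ p q x∈p∪q)

  ⊆-total⇒∣p∪q∣≤∣p∣⊔∣q∣ : p ⊆ q ⊎ q ⊆ p → ∣ p ∪ q ∣ ≤ ∣ p ∣ ⊔ ∣ q ∣
  ⊆-total⇒∣p∪q∣≤∣p∣⊔∣q∣ {p = p} {q = q} (inj₁ p⊆q) =
    ≤-trans (p⊆q⇒∣p∣≤∣q∣ (∪-lub p⊆q ⊆-refl)) (m≤n⊔m ∣ p ∣ ∣ q ∣)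
  ⊆-total⇒∣p∪q∣≤∣p∣⊔∣q∣ {p = p} {q = q} (inj₂ q⊆p) =
    ≤-trans (p⊆q⇒∣p∣≤∣q∣ (∪-lub ⊆-refl q⊆p)) (m≤m⊔n ∣ p ∣ ∣ q ∣)

  p⊆q∧∣q∣≤∣p∣⇒q⊆p : p ⊆ q → ∣ q ∣ ≤ ∣ p ∣ → q ⊆ p
  p⊆q∧∣q∣≤∣p∣⇒q⊆p {p = p} p⊆q ∣q∣≤∣p∣ {x} x∈q with x ∈? p
  ... | yes x∈p = x∈p
  ... | no  x∉p = contradiction ∣q∣≤∣p∣ (<⇒≱ (p⊂q⇒∣p∣<∣q∣ (p⊆q , x , x∈q , x∉p)))

  x∈p⇒0<∣p∣ : ∀ {x : Fin n} → x ∈ p → 0 < ∣ p ∣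
  x∈p⇒0<∣p∣ {n} {p} {x} x∈p = subst (_< ∣ p ∣) (∣⊥∣≡0 n) (p⊂q⇒∣p∣<∣q∣ (⊥⊆ , x , x∈p , ∉⊥))

  x∉p⇒∣p∣<n : ∀ {x : Fin n} → x ∉ p → ∣ p ∣ < n
  x∉p⇒∣p∣<n {n} {p} {x} x∉p = subst (∣ p ∣ <_) (∣⊤∣≡n n) (p⊂q⇒∣p∣<∣q∣ (⊆⊤ , x , ∈⊤ , x∉p))

  x∉p⇒p≢⊤ : ∀ {x : Fin n} → x ∉ p → p ≢ ⊤
  x∉p⇒p≢⊤ x∉p refl = x∉p ∈⊤

  ∃-⊆-between : ∀ m → p ⊆ q → ∣ p ∣ ≤ m → m ≤ ∣ q ∣ → ∃ λ r → p ⊆ r × r ⊆ q × ∣ r ∣ ≡ m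
  ∃-⊆-between {p = []} {q = []} m _ _ m≤0 = [] , ⊆-refl , ⊆-refl , sym (n≤0⇒n≡0 m≤0)
  ∃-⊆-between {p = inside ∷ p} {q = outside ∷ q} m p⊆q _ _ with () ← p⊆q here
  ∃-⊆-between {p = inside ∷ p} {q = inside ∷ q} (suc m) p⊆q (s≤s ∣p∣≤m) (s≤s m≤∣q∣)
    with r , p⊆r , r⊆q , ∣r∣≡m ← ∃-⊆-between m (drop-∷-⊆ p⊆q) ∣p∣≤m m≤∣q∣
    = inside ∷ r , in⊆in p⊆r , in⊆in r⊆q , cong suc ∣r∣≡m
  ∃-⊆-between {p = outside ∷ p} {q = outside ∷ q} m p⊆q ∣p∣≤m m≤∣q∣
    with r , p⊆r , r⊆q , ∣r∣≡m ← ∃-⊆-between m (drop-∷-⊆ p⊆q) ∣p∣≤m m≤∣q∣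
    = outside ∷ r , s⊆s p⊆r , s⊆s r⊆q , ∣r∣≡m
  ∃-⊆-between {p = outside ∷ p} {q = inside ∷ q} m p⊆q ∣p∣≤m m≤1+∣q∣ with m ≤? ∣ q ∣
  ... | yes m≤∣q∣
    with r , p⊆r , r⊆q , ∣r∣≡m ← ∃-⊆-between m (drop-∷-⊆ p⊆q) ∣p∣≤m m≤∣q∣
    = outside ∷ r , s⊆s p⊆r , out⊆ r⊆q , ∣r∣≡m
  ... | no  m≰∣q∣ = inside ∷ q , p⊆q , ⊆-refl , ≤-antisym (≰⇒> m≰∣q∣) m≤1+∣q∣

  ∃-⊇-of-size : ∀ {n} {p : Subset n} m → ∣ p ∣ ≤ m → m ≤ n → ∃ λ r → p ⊆ r × ∣ r ∣ ≡ m
  ∃-⊇-of-size {n} m ∣p∣≤m m≤n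
    with r , p⊆r , _ , ∣r∣≡m ← ∃-⊆-between m ⊆⊤ ∣p∣≤m (subst (m ≤_) (sym (∣⊤∣≡n n)) m≤n)
    = r , p⊆r , ∣r∣≡m

  ∃-⊆-comparable : ∀ {n} {p q : Subset n} m → p ⊆ q → ∣ p ∣ ≤ m → m ≤ n →
                   ∃ λ r → p ⊆ r × ∣ r ∣ ≡ m × (q ⊆ r ⊎ r ⊆ q)
  ∃-⊆-comparable {q = q} m p⊆q ∣p∣≤m m≤n with m ≤? ∣ q ∣
  ... | yes m≤∣q∣
    with r , p⊆r , r⊆q , ∣r∣≡m ← ∃-⊆-between m p⊆q ∣p∣≤m m≤∣q∣
    = r , p⊆r , ∣r∣≡m , inj₂ r⊆q
  ... | no  m≰∣q∣
    with r , q⊆r , ∣r∣≡m ← ∃-⊇-of-size m (<⇒≤ (≰⇒> m≰∣q∣)) m≤n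
    = r , ⊆-trans p⊆q q⊆r , ∣r∣≡m , inj₁ q⊆r

module NatBounds where

  open import Data.Nat using (zero; suc; _+_; _≤_; _<_; _⊔_; s≤s; z≤n)
  open import Data.Nat.Properties
  open import Data.Sum using (inj₁; inj₂)
  open import Relation.Nullary using (contradiction)
  open import Relation.Binary.PropositionalEquality using (subst)

  m+n≤o⊔n⇒m+n≤o : ∀ {m n o} → 0 < m → m + n ≤ o ⊔ n → m + n ≤ o
  m+n≤o⊔n⇒m+n≤o {m} {n} {o} 0<m m+n≤o⊔n with ⊔-sel o n
  ... | inj₁ o⊔n≡o = subst (m + n ≤_) o⊔n≡o m+n≤o⊔n
  ... | inj₂ o⊔n≡n = contradiction (subst (m + n ≤_) o⊔n≡n m+n≤o⊔n) (<⇒≱ (m<n+m n 0<m))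

  m+n≤o⊔n⇒m<o : ∀ {m n o} → 0 < n → 0 < o → m + n ≤ o ⊔ n → m < o
  m+n≤o⊔n⇒m<o {zero}          _   0<o _         = 0<o
  m+n≤o⊔n⇒m<o {m@(suc _)} {n} 0<n _   m+n≤o⊔n =
    <-≤-trans (m<m+n m 0<n) (m+n≤o⊔n⇒m+n≤o (s≤s z≤n) m+n≤o⊔n)

module Neighbourhoods where

  open import Defs hiding (sym)
  open import Data.Bool using (Bool; true)
  open import Data.Bool.Properties using (T-≡)
  open import Data.Nat using (ℕ; zero; suc; _+_; _∸_; _≤_; _<_; _⊔_; _⊓_; _≤ᵇ_)
  open import Data.Nat.Properties
  open import Data.Fin using (Fin; zero; suc)
  open import Data.Fin.Subset using (Subset; _∈_; _∉_; _⊆_; _∩_; _∪_; ∁; ⁅_⁆; ∣_∣; Empty)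
  open import Data.Fin.Subset.Properties
  open import Data.Vec using (tabulate; foldr₁)
  open import Data.Vec.Properties using (lookup∘tabulate; []=⇒lookup; lookup⇒[]=)
  open import Data.Product using (Σ; ∃; _×_; _,_)
  open import Data.Sum using (inj₁; inj₂)
  open import Function using (_∘_; Equivalence)
  open import Relation.Binary.PropositionalEquality using (_≡_; refl; sym; trans; cong; subst)
  open SubsetCounting
  open NatBounds

  foldr₁-⊓-attained : ∀ {m} (f : Fin (suc m) → ℕ) → ∃ λ i → foldr₁ _⊓_ (tabulate f) ≡ f i
  foldr₁-⊓-attained {zero}  f = zero , refl
  foldr₁-⊓-attained {suc m} f with ⊓-sel (f zero) (foldr₁ _⊓_ (tabulate (f ∘ suc)))
  ... | inj₁ min≡f0 = zero , min≡f0
  ... | inj₂ min≡rest with i , rest≡fi ← foldr₁-⊓-attained (f ∘ suc) = suc i , trans min≡rest rest≡fi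

  δ-attained : ∀ {n} (G : Graph n) → 0 < n → ∃ λ v → δ G ≡ degree G v
  δ-attained {suc n} G _ = foldr₁-⊓-attained (degree G)

  ∈tabulate⁺ : ∀ {n} (f : Fin n → Bool) {x} → f x ≡ true → x ∈ tabulate f
  ∈tabulate⁺ f {x} fx≡true = lookup⇒[]= x (tabulate f) (trans (lookup∘tabulate f x) fx≡true)

  ∈tabulate⁻ : ∀ {n} (f : Fin n → Bool) {x} → x ∈ tabulate f → f x ≡ true
  ∈tabulate⁻ f {x} x∈ = trans (sym (lookup∘tabulate f x)) ([]=⇒lookup x∈)

  module _ {n : ℕ} (G : Graph n) where

    N-sym : ∀ {u v} → u ∈ N G v → v ∈ N G u
    N-sym {u} {v} u∈Nv = ∈tabulate⁺ (adj G u) (trans (Graph.sym G u v) (∈tabulate⁻ (adj G v) u∈Nv))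

    N-irreflexive : ∀ {v} → v ∉ N G v
    N-irreflexive {v} v∈Nv with () ← trans (sym (∈tabulate⁻ (adj G v) v∈Nv)) (irrfl G v)

    ∈Λ⁻ : ∀ {k S v} → v ∈ Λ k G S → k ≤ ∣ N G v ∩ S ∣
    ∈Λ⁻ {k} {S} {v} v∈Λ =
      ≤ᵇ⇒≤ k _ (Equivalence.from T-≡ (∈tabulate⁻ (λ w → k ≤ᵇ ∣ N G w ∩ S ∣) v∈Λ))

    ∉Λ : ∀ {k S v} → ∣ N G v ∩ S ∣ < k → v ∉ Λ k G S
    ∉Λ ∣Nv∩S∣<k v∈Λ = <⇒≱ ∣Nv∩S∣<k (∈Λ⁻ v∈Λ)

    Λ-saturated : ∀ {k S w} → ∣ S ∣ ≤ k → w ∈ Λ k G S → S ⊆ N G w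
    Λ-saturated {S = S} {w} ∣S∣≤k w∈Λ = ⊆-trans S⊆Nw∩S (p∩q⊆p (N G w) S)
      where
      S⊆Nw∩S : S ⊆ N G w ∩ S
      S⊆Nw∩S = p⊆q∧∣q∣≤∣p∣⇒q⊆p (p∩q⊆q (N G w) S) (≤-trans ∣S∣≤k (∈Λ⁻ w∈Λ))

    Λ⊆N : ∀ {k S v} → ∣ S ∣ ≤ k → v ∈ S → Λ k G S ⊆ N G v
    Λ⊆N ∣S∣≤k v∈S w∈Λ = N-sym (Λ-saturated ∣S∣≤k w∈Λ v∈S)

    Λ∩S-empty : ∀ {k S} → ∣ S ∣ ≤ k → Empty (Λ k G S ∩ S)
    Λ∩S-empty {k} {S} ∣S∣≤k (w , w∈Λ∩S) with w∈Λ , w∈S ← x∈p∩q⁻ (Λ k G S) S w∈Λ∩S =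
      N-irreflexive (Λ-saturated ∣S∣≤k w∈Λ w∈S)

    ∃-admissible-with-small-Λ : ∀ {k} → 0 < k → k ≤ n → ∀ v →
      Σ (Subset n) λ S → Admissible k G S × ∣ S ∣ ≡ k × ∣ Λ k G S ∣ + k ≤ suc (degree G v) ⊔ k
    ∃-admissible-with-small-Λ {k} 0<k k≤n v
      with S , ⁅v⁆⊆S , ∣S∣≡k , comparable ←
             ∃-⊆-comparable k (p⊆p∪q (N G v)) (subst (_≤ k) (sym (∣⁅x⁆∣≡1 v)) 0<k) k≤n
      = S , (≤-reflexive (sym ∣S∣≡k) , x∉p⇒p≢⊤ v∉Λ) , ∣S∣≡k , bound
      where
      N[v] : Subset n
      N[v] = ⁅ v ⁆ ∪ N G v
      ∣S∣≤k : ∣ S ∣ ≤ k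
      ∣S∣≤k = ≤-reflexive ∣S∣≡k
      v∈S : v ∈ S
      v∈S = ⁅v⁆⊆S (x∈⁅x⁆ v)
      v∉Λ : v ∉ Λ k G S
      v∉Λ v∈Λ = N-irreflexive (Λ⊆N ∣S∣≤k v∈S v∈Λ)
      Λ∪S⊆N[v]∪S : Λ k G S ∪ S ⊆ N[v] ∪ S
      Λ∪S⊆N[v]∪S = ∪-lub (⊆-trans (Λ⊆N ∣S∣≤k v∈S) (⊆-trans (q⊆p∪q ⁅ v ⁆ (N G v)) (p⊆p∪q S)))
                         (q⊆p∪q N[v] S)
      ∣N[v]∣≤1+d : ∣ N[v] ∣ ≤ suc (degree G v)
      ∣N[v]∣≤1+d = subst (λ i → ∣ N[v] ∣ ≤ i + degree G v) (∣⁅x⁆∣≡1 v) (∣p∪q∣≤∣p∣+∣q∣ ⁅ v ⁆ (N G v))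
      bound : ∣ Λ k G S ∣ + k ≤ suc (degree G v) ⊔ k
      bound = begin
        ∣ Λ k G S ∣ + k        ≡⟨ cong (∣ Λ k G S ∣ +_) ∣S∣≡k ⟨
        ∣ Λ k G S ∣ + ∣ S ∣    ≡⟨ Empty[p∩q]⇒∣p∪q∣≡∣p∣+∣q∣ (Λ k G S) S (Λ∩S-empty ∣S∣≤k) ⟨
        ∣ Λ k G S ∪ S ∣        ≤⟨ p⊆q⇒∣p∣≤∣q∣ Λ∪S⊆N[v]∪S ⟩
        ∣ N[v] ∪ S ∣           ≤⟨ ⊆-total⇒∣p∪q∣≤∣p∣⊔∣q∣ comparable ⟩
        ∣ N[v] ∣ ⊔ ∣ S ∣       ≤⟨ ⊔-mono-≤ ∣N[v]∣≤1+d ∣S∣≤k ⟩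
        suc (degree G v) ⊔ k   ∎
        where open ≤-Reasoning

    ∁N⊆S⇒v∉Λ : ∀ {k S v} → 0 < k → ∁ (N G v) ⊆ S → ∣ S ∣ ≤ k ⊔ ∣ ∁ (N G v) ∣ → v ∉ Λ k G S
    ∁N⊆S⇒v∉Λ {k} {S} {v} 0<k C⊆S ∣S∣≤k⊔∣C∣ =
      ∉Λ (m+n≤o⊔n⇒m<o (x∈p⇒0<∣p∣ (x∉p⇒x∈∁p N-irreflexive)) 0<k ∣Nv∩S∣+∣C∣≤k⊔∣C∣)
      where
      C : Subset n
      C = ∁ (N G v)
      Nv∩S∩C-empty : Empty ((N G v ∩ S) ∩ C)
      Nv∩S∩C-empty (w , w∈Nv∩S∩C) with w∈Nv∩S , w∈C ← x∈p∩q⁻ (N G v ∩ S) C w∈Nv∩S∩C =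
        x∈p⇒x∉∁p (p∩q⊆p (N G v) S w∈Nv∩S) w∈C
      ∣Nv∩S∣+∣C∣≤k⊔∣C∣ : ∣ N G v ∩ S ∣ + ∣ C ∣ ≤ k ⊔ ∣ C ∣
      ∣Nv∩S∣+∣C∣≤k⊔∣C∣ = begin
        ∣ N G v ∩ S ∣ + ∣ C ∣    ≡⟨ Empty[p∩q]⇒∣p∪q∣≡∣p∣+∣q∣ (N G v ∩ S) C Nv∩S∩C-empty ⟨
        ∣ (N G v ∩ S) ∪ C ∣      ≤⟨ p⊆q⇒∣p∣≤∣q∣ (∪-lub (p∩q⊆q (N G v) S) C⊆S) ⟩
        ∣ S ∣                    ≤⟨ ∣S∣≤k⊔∣C∣ ⟩
        k ⊔ ∣ C ∣                ∎
        where open ≤-Reasoning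

    ∁N⊆S⇒n≤∣S∣+deg : ∀ {S v} → ∁ (N G v) ⊆ S → n ≤ ∣ S ∣ + degree G v
    ∁N⊆S⇒n≤∣S∣+deg {S} {v} C⊆S = begin
      n                                ≡⟨ m∸n+n≡m (∣p∣≤n (N G v)) ⟨
      n ∸ degree G v + degree G v      ≡⟨ cong (_+ degree G v) (∣∁p∣≡n∸∣p∣ (N G v)) ⟨
      ∣ ∁ (N G v) ∣ + degree G v       ≤⟨ +-monoˡ-≤ (degree G v) (p⊆q⇒∣p∣≤∣q∣ C⊆S) ⟩
      ∣ S ∣ + degree G v               ∎
      where open ≤-Reasoning

    ∃-admissible-avoiding : ∀ {k} → 0 < k → k ≤ n → ∀ v →
      Σ (Subset n) λ S → Admissible k G S × ∣ Λ k G S ∣ < n × n ≤ ∣ S ∣ + degree G v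
    ∃-admissible-avoiding {k} 0<k k≤n v
      with S , C⊆S , ∣S∣≡k⊔∣C∣ ←
             ∃-⊇-of-size (k ⊔ ∣ ∁ (N G v) ∣) (m≤n⊔m k _) (⊔-lub k≤n (∣p∣≤n (∁ (N G v))))
      = S , (k≤∣S∣ , x∉p⇒p≢⊤ v∉Λ) , x∉p⇒∣p∣<n v∉Λ , ∁N⊆S⇒n≤∣S∣+deg C⊆S
      where
      k≤∣S∣ : k ≤ ∣ S ∣
      k≤∣S∣ = subst (k ≤_) (sym ∣S∣≡k⊔∣C∣) (m≤m⊔n k _)
      v∉Λ : v ∉ Λ k G S
      v∉Λ = ∁N⊆S⇒v∉Λ 0<k C⊆S (≤-reflexive ∣S∣≡k⊔∣C∣)

module NatsInRationals where

  open import Defs using (ratio; divPos)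
  open import Data.Nat as ℕ using (ℕ; zero; suc; z≤n)
  import Data.Nat.Properties as ℕ
  open import Data.Nat.Coprimality using (1-coprimeTo) renaming (sym to coprime-sym)
  open import Data.Integer as ℤ using (+_)
  import Data.Integer.Properties as ℤ
  import Data.Rational.Unnormalised as ℚᵘ
  import Data.Rational.Unnormalised.Properties as ℚᵘ
  open import Data.Rational
  open import Data.Rational.Properties
  open import Data.Rational.Solver using (module +-*-Solver)
  open import Relation.Binary.PropositionalEquality
    using (_≡_; refl; sym; trans; cong; cong₂; subst)
  open +-*-Solver

  fromℕ : ℕ → ℚ
  fromℕ n = + n / 1

  fromℕ≡mkℚ : ∀ n → fromℕ n ≡ mkℚ (+ n) 0 (coprime-sym (1-coprimeTo n))
  fromℕ≡mkℚ n = normalize-coprime (coprime-sym (1-coprimeTo n))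

  fromℕ-+ : ∀ m n → fromℕ (m ℕ.+ n) ≡ fromℕ m + fromℕ n
  fromℕ-+ m n rewrite fromℕ≡mkℚ m | fromℕ≡mkℚ n =
    /-cong (trans (ℤ.pos-+ m n) (sym (cong₂ ℤ._+_ (ℤ.*-identityʳ (+ m)) (ℤ.*-identityʳ (+ n))))) refl

  fromℕ-mono-≤ : ∀ {m n} → m ℕ.≤ n → fromℕ m ≤ fromℕ n
  fromℕ-mono-≤ {m} {n} m≤n rewrite fromℕ≡mkℚ m | fromℕ≡mkℚ n =
    *≤* (ℤ.*-monoʳ-≤-nonNeg (+ 1) (ℤ.+≤+ m≤n))

  fromℕ-nonNeg : ∀ n → NonNegative (fromℕ n)
  fromℕ-nonNeg n = nonNegative (fromℕ-mono-≤ {0} {n} z≤n)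

  ratio*fromℕ-cancel : ∀ m n → ratio m (suc n) * fromℕ (suc n) ≡ fromℕ m
  ratio*fromℕ-cancel m n = toℚᵘ-injective (begin-equality
    toℚᵘ (ratio m (suc n) * fromℕ (suc n))      ≃⟨ toℚᵘ-homo-* (ratio m (suc n)) (fromℕ (suc n)) ⟩
    toℚᵘ (ratio m (suc n)) ℚᵘ.* toℚᵘ (fromℕ (suc n))
                                                ≃⟨ ℚᵘ.*-cong (toℚᵘ-fromℚᵘ (ℚᵘ.mkℚᵘ (+ m) n))
                                                             (toℚᵘ-fromℚᵘ (ℚᵘ.mkℚᵘ (+ suc n) 0)) ⟩
    ℚᵘ.mkℚᵘ (+ m) n ℚᵘ.* ℚᵘ.mkℚᵘ (+ suc n) 0    ≃⟨ ℚᵘ.*≡* (ℤ.*-assoc (+ m) (+ suc n) (+ 1)) ⟩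
    ℚᵘ.mkℚᵘ (+ m) 0                             ≃⟨ toℚᵘ-fromℚᵘ (ℚᵘ.mkℚᵘ (+ m) 0) ⟨
    toℚᵘ (fromℕ m)                              ∎)
    where open ℚᵘ.≤-Reasoning

  ratio-zero : ∀ n → ratio 0 n ≡ 0ℚ
  ratio-zero zero    = refl
  ratio-zero (suc n) = 0/n≡0 (suc n)

  ≤ratio⇒*≤ : ∀ β m n → 0 ℕ.< n → β ≤ ratio m n → β * fromℕ n ≤ fromℕ m
  ≤ratio⇒*≤ β m (suc n) _ β≤m/n = subst (β * fromℕ (suc n) ≤_) (ratio*fromℕ-cancel m n)
    (*-monoʳ-≤-nonNeg (fromℕ (suc n)) {{fromℕ-nonNeg (suc n)}} β≤m/n)

  fromℕ-suc : ∀ n → fromℕ (suc n) ≡ fromℕ n + 1ℚ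
  fromℕ-suc n = trans (cong fromℕ (ℕ.+-comm 1 n)) (fromℕ-+ n 1)

  p*q≤r⇒q≤r÷p : ∀ {p q r} (0<p : 0ℚ < p) → p * q ≤ r → q ≤ divPos r p 0<p
  p*q≤r⇒q≤r÷p {p} {q} {r} 0<p p*q≤r = begin
    q                  ≡⟨ *-identityʳ q ⟨
    q * 1ℚ             ≡⟨ cong (q *_) (*-inverseʳ p) ⟨
    q * (p * 1/ p)     ≡⟨ solve 3 (λ q p p⁻¹ → q :* (p :* p⁻¹) := (p :* q) :* p⁻¹) refl q p (1/ p) ⟩
    (p * q) * 1/ p     ≤⟨ *-monoʳ-≤-nonNeg (1/ p) {{pos⇒nonNeg (1/ p) {{1/pos⇒pos p}}}} p*q≤r ⟩
    r * 1/ p           ∎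
    where
    open ≤-Reasoning
    instance
      p-positive : Positive p
      p-positive = positive 0<p
      p-nonZero : NonZero p
      p-nonZero = pos⇒nonZero p

  βk≤L∧L+k≤1+d⇒[β+1]k-1≤d : ∀ β L k d → β * fromℕ k ≤ fromℕ L → L ℕ.+ k ℕ.≤ suc d →
                             (β + 1ℚ) * fromℕ k - 1ℚ ≤ fromℕ d
  βk≤L∧L+k≤1+d⇒[β+1]k-1≤d β L k d βk≤L L+k≤1+d = begin
    (β + 1ℚ) * fromℕ k - 1ℚ       ≡⟨ solve 2 (λ β k → (β :+ con 1ℚ) :* k :- con 1ℚ
                                                     := β :* k :+ k :- con 1ℚ) refl β (fromℕ k) ⟩
    β * fromℕ k + fromℕ k - 1ℚ    ≤⟨ +-monoˡ-≤ (- 1ℚ) (+-monoˡ-≤ (fromℕ k) βk≤L) ⟩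
    fromℕ L + fromℕ k - 1ℚ        ≡⟨ cong (_- 1ℚ) (fromℕ-+ L k) ⟨
    fromℕ (L ℕ.+ k) - 1ℚ          ≤⟨ +-monoˡ-≤ (- 1ℚ) (fromℕ-mono-≤ L+k≤1+d) ⟩
    fromℕ (suc d) - 1ℚ            ≡⟨ cong (_- 1ℚ) (fromℕ-suc d) ⟩
    fromℕ d + 1ℚ - 1ℚ             ≡⟨ solve 1 (λ d → d :+ con 1ℚ :- con 1ℚ := d) refl (fromℕ d) ⟩
    fromℕ d                       ∎
    where open ≤-Reasoning

  βs≤L∧L<n∧n≤s+d⇒n-[n-1]/β≤d : ∀ β s L n d (0<β : 0ℚ < β) →
                                β * fromℕ s ≤ fromℕ L → L ℕ.< n → n ℕ.≤ s ℕ.+ d →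
                                fromℕ n - divPos (fromℕ n - 1ℚ) β 0<β ≤ fromℕ d
  βs≤L∧L<n∧n≤s+d⇒n-[n-1]/β≤d β s L n d 0<β βs≤L L<n n≤s+d = begin
    fromℕ n - divPos (fromℕ n - 1ℚ) β 0<β   ≤⟨ +-monoʳ-≤ (fromℕ n) (neg-antimono-≤ s≤[n-1]/β) ⟩
    fromℕ n - fromℕ s              ≤⟨ +-monoˡ-≤ (- fromℕ s) (fromℕ-mono-≤ n≤s+d) ⟩
    fromℕ (s ℕ.+ d) - fromℕ s      ≡⟨ cong (_- fromℕ s) (fromℕ-+ s d) ⟩
    fromℕ s + fromℕ d - fromℕ s    ≡⟨ solve 2 (λ s d → s :+ d :- s := d) refl (fromℕ s) (fromℕ d) ⟩
    fromℕ d                        ∎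
    where
    open ≤-Reasoning
    L≤n-1 : fromℕ L ≤ fromℕ n - 1ℚ
    L≤n-1 = begin
      fromℕ L                ≡⟨ solve 1 (λ L → L := L :+ con 1ℚ :- con 1ℚ) refl (fromℕ L) ⟩
      fromℕ L + 1ℚ - 1ℚ      ≡⟨ cong (_- 1ℚ) (fromℕ-suc L) ⟨
      fromℕ (suc L) - 1ℚ     ≤⟨ +-monoˡ-≤ (- 1ℚ) (fromℕ-mono-≤ L<n) ⟩
      fromℕ n - 1ℚ           ∎
    s≤[n-1]/β : fromℕ s ≤ divPos (fromℕ n - 1ℚ) β 0<β
    s≤[n-1]/β = p*q≤r⇒q≤r÷p 0<β (≤-trans βs≤L L≤n-1)

open import Defs
open import Data.Nat using (ℕ; s≤s; z≤n) renaming (_≤_ to _≤ℕ_; _<_ to _<ℕ_)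
import Data.Nat.Properties as ℕ
open import Data.Integer using (+_)
open import Data.Rational using (ℚ; 0ℚ; 1ℚ; _+_; _-_; _*_; _≤_; _<_; _⊔_; _/_)
open import Data.Rational.Properties using (<-≤-trans; positive⁻¹; <-irrefl; ⊔-lub)
open import Data.Fin.Subset using (∣_∣)
open import Data.Product using (_×_; _,_)
open import Data.Sum using (inj₁; inj₂)
open import Data.Empty using (⊥-elim)
open import Relation.Binary.PropositionalEquality using (refl; subst)
open NatBounds using (m+n≤o⊔n⇒m+n≤o)
open NatsInRationals
  using (fromℕ; ratio-zero; ≤ratio⇒*≤; βk≤L∧L+k≤1+d⇒[β+1]k-1≤d; βs≤L∧L<n∧n≤s+d⇒n-[n-1]/β≤d)
open Neighbourhoods using (δ-attained; ∃-admissible-with-small-Λ; ∃-admissible-avoiding)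

module DegreeBounds {n k} (G : Graph n) {β : ℚ} (0<k : 0 <ℕ k) (k≤n : k ≤ℕ n)
                    (β-minimal : ∀ S → Admissible k G S → β ≤ ratio ∣ Λ k G S ∣ ∣ S ∣) where

  degree≥[β+1]k-1 : 0ℚ < β → ∀ v → (β + 1ℚ) * fromℕ k - 1ℚ ≤ fromℕ (degree G v)
  degree≥[β+1]k-1 0<β v
    with S , S-admissible , ∣S∣≡k , ∣Λ∣+k≤[1+d]⊔k ← ∃-admissible-with-small-Λ G 0<k k≤n v
    = βk≤L∧L+k≤1+d⇒[β+1]k-1≤d β ∣ Λ k G S ∣ k (degree G v)
        (≤ratio⇒*≤ β _ k 0<k β≤∣Λ∣/k) (m+n≤o⊔n⇒m+n≤o 0<∣Λ∣ ∣Λ∣+k≤[1+d]⊔k)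
    where
    β≤∣Λ∣/k : β ≤ ratio ∣ Λ k G S ∣ k
    β≤∣Λ∣/k = subst (λ s → β ≤ ratio ∣ Λ k G S ∣ s) ∣S∣≡k (β-minimal S S-admissible)
    0<∣Λ∣ : 0 <ℕ ∣ Λ k G S ∣
    0<∣Λ∣ = ℕ.n≢0⇒n>0 λ ∣Λ∣≡0 → <-irrefl refl (<-≤-trans 0<β
      (subst (β ≤_) (ratio-zero k) (subst (λ L → β ≤ ratio L k) ∣Λ∣≡0 β≤∣Λ∣/k)))

  degree≥n-[n-1]/β : (0<β : 0ℚ < β) → ∀ v → fromℕ n - divPos (fromℕ n - 1ℚ) β 0<β ≤ fromℕ (degree G v)
  degree≥n-[n-1]/β 0<β v
    with S , S-admissible@(k≤∣S∣ , _) , ∣Λ∣<n , n≤∣S∣+d ← ∃-admissible-avoiding G 0<k k≤n v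
    = βs≤L∧L<n∧n≤s+d⇒n-[n-1]/β≤d β ∣ S ∣ ∣ Λ k G S ∣ n (degree G v) 0<β
        (≤ratio⇒*≤ β _ ∣ S ∣ (ℕ.<-≤-trans 0<k k≤∣S∣) (β-minimal S S-admissible)) ∣Λ∣<n n≤∣S∣+d

  δ≥[β+1]k-1 : 0ℚ < β → (β + 1ℚ) * fromℕ k - 1ℚ ≤ fromℕ (δ G)
  δ≥[β+1]k-1 0<β with v , δ≡deg[v] ← δ-attained G (ℕ.<-≤-trans 0<k k≤n) rewrite δ≡deg[v] =
    degree≥[β+1]k-1 0<β v

  δ≥n-[n-1]/β : (0<β : 0ℚ < β) → fromℕ n - divPos (fromℕ n - 1ℚ) β 0<β ≤ fromℕ (δ G)
  δ≥n-[n-1]/β 0<β with v , δ≡deg[v] ← δ-attained G (ℕ.<-≤-trans 0<k k≤n) rewrite δ≡deg[v] =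
    degree≥n-[n-1]/β 0<β v

lemma2p5 : (k n : ℕ) → 2 ≤ℕ k → (G : Graph n) → (β : ℚ) → IsBeta k G β
    → ((0ℚ < β → ((β + 1ℚ) * (+ k / 1)) - 1ℚ ≤ + δ G / 1)
       × ((h : 1ℚ ≤ β) → (((β + 1ℚ) * (+ k / 1)) - 1ℚ) ⊔ ((+ n / 1) - divPos ((+ n / 1) - 1ℚ) β (<-≤-trans (positive⁻¹ 1ℚ) h)) ≤ + δ G / 1))
lemma2p5 k n 2≤k G β (inj₁ (_ , refl)) =
  (λ 0<0 → ⊥-elim (<-irrefl refl 0<0)) , (λ 1≤0 → ⊥-elim (<-irrefl refl (<-≤-trans (positive⁻¹ 1ℚ) 1≤0)))
lemma2p5 k n 2≤k G β (inj₂ (k≤n , _ , β-minimal)) =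
  δ≥[β+1]k-1 , λ 1≤β → ⊔-lub (δ≥[β+1]k-1 (0<β 1≤β)) (δ≥n-[n-1]/β (0<β 1≤β))
  where
  open DegreeBounds G (ℕ.<-≤-trans (s≤s z≤n) 2≤k) k≤n β-minimal
  0<β : 1ℚ ≤ β → 0ℚ < β
  0<β = <-≤-trans (positive⁻¹ 1ℚ)
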